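{- Let $m\geqslant 2$ and let $n$ be a positive integer. If $m\geqslant 3$, then the maximum of $b_m(\boldsymbol{\lambda})$ over all $m$-ary partitions $\boldsymbol{\lambda}$ of $n$ is attained at the partition consisting of $\lfloor n/m\rfloor$ parts equal to $m$ and $n-m\lfloor n/m\rfloor$ parts equal to $1$. If $m=2$, this maximum is attained at each of the partitions consisting of $i$ parts equal to $4$, $\lfloor n/2\rfloor-2i$ parts equal to $2$, and $n-2\lfloor n/2\rfloor$ parts equal to $1$, where $0\leqslant i\leqslant\lfloor n/4\rfloor$. In particular, for every $m\geqslant 2$, $$\max\{b_m(\boldsymbol{\lambda}):\boldsymbol{\lambda}\text{ an } m\text{ -ary partition of } n\}=2^{\lfloor n/m\rfloor}.$$
   Context: For an integer $m\geqslant2$, an $m$-ary partition of $n$ is a partition of $n$ all of whose parts belong to $\{1,m,m^2,\ldots\}$, and $b_m(n)$ is the number of $m$-ary partitions of $n$. The extended $m$-ary partition function is defined on an $m$-ary partition $\boldsymbol{\lambda}=(\lambda_1,\ldots,\lambda_j)$ by $b_m(\boldsymbol{\lambda})=\prod_{i=1}^j b_m(\lambda_i)$. -}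

module Defs where

open import Data.Nat using (ℕ; zero; suc; _+_; _*_; _^_; _≥_; _≤_)
open import Data.Nat.Properties using (_≟_; _≥?_)
open import Data.List using (List; []; _∷_; map; concatMap; length; filter; upTo)
open import Data.Nat.ListAction using (sum; product)
open import Relation.Binary.PropositionalEquality using (_≡_)
open import Data.List.Relation.Unary.Linked using (Linked; linked?)
open import Data.List.Relation.Unary.All using (All)
open import Data.Product using (∃; ∃-syntax; _×_)

allLists : ℕ → List ℕ → List (List ℕ)
allLists zero    A = [] ∷ []
allLists (suc l) A = [] ∷ concatMap (λ a → map (a ∷_) (allLists l A)) A

-- An m-ary partition of n, encoded by its non-increasing list of exponents
-- (j₁ ≥ j₂ ≥ … with n = m^j₁ + m^j₂ + …).
-- Every such list (for m ≥ 2) has length ≤ n and entries ≤ n, so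
-- it occurs in allLists n (upTo (suc n)); we count them by filtering.
b : ℕ → ℕ → ℕ
b m n = length (filter (λ js → linked? _≥?_ js) (filter (λ js → sum (map (m ^_) js) ≟ n)
          (allLists n (upTo (suc n)))))

IsPowOf : ℕ → ℕ → Set
IsPowOf m k = ∃[ j ] m ^ j ≡ k

MaryPartition : ℕ → ℕ → List ℕ → Set
MaryPartition m n λs = Linked _≥_ λs × All (IsPowOf m) λs × sum λs ≡ n

bExt : ℕ → List ℕ → ℕ
bExt m λs = product (map (b m) λs)

AttainsMax : ℕ → ℕ → List ℕ → Set
AttainsMax m n λs = MaryPartition m n λs × (∀ μ → MaryPartition m n μ → bExt m μ ≤ bExt m λs)

module Submission where

-- Let bBounded n c count the m-ary partitions of n into parts at most m ^ c. Removing the parts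
-- equal to 1 gives bBounded n (c + 1) = Σ_{i ≤ ⌊n/m⌋} bBounded i c, and since ⌊(k+1)/m⌋ ≤ k we
-- have Σ_{i ≤ k} 2 ^ ⌊i/m⌋ ≤ 2 ^ k, so bBounded n c ≤ 2 ^ ⌊n/m⌋ by induction on c; in particular
-- b_m(n) = bBounded n n ≤ 2 ^ ⌊n/m⌋. As ⌊·/m⌋ is superadditive, b_m(λ) ≤ 2 ^ ⌊n/m⌋ for every
-- m-ary partition λ of n, and b_m(1) ≥ 1, b_m(m) ≥ 2, b_2(4) = 4 show that the listed partitions
-- attain this bound. The enumeration defining b is compared with bBounded by splitting off the
-- largest part.

open import Defs
open import Data.Nat
  using (ℕ; zero; suc; pred; _+_; _*_; _∸_; _^_; _/_; _≤_; _<_; _≥_; _≤′_; ≤′-refl; ≤′-step; _≤?_; _<?_; z≤n; s≤s; NonZero; >-nonZero)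
open import Data.Nat.Properties
open import Data.Nat.DivMod
  using (0/n≡0; m/n<m; m/n*n≤m; /-monoˡ-≤; m*n/n≡m; [m∸n]/n≡m/n∸1; [m∸n*o]/o≡m/o∸n; m≥n⇒m/n>0; m/n/o≡m/[n*o])
open import Data.Nat.Tactic.RingSolver using (solve-∀)
open import Data.Bool using (Bool; true; false; _∧_; if_then_else_; T)
open import Data.Bool.Properties using (∧-zeroʳ; ∧-identityʳ; T-∧)
open import Data.Empty using (⊥-elim)
open import Data.Product using (_×_; _,_; proj₁; ∃-syntax)
open import Data.List using (List; []; _∷_; _++_; map; concatMap; length; filter; upTo; replicate)
open import Data.List.Properties using (upTo-∷ʳ; map-++; map-cong; map-replicate; length-replicate; ++-identityʳ)
open import Data.Nat.ListAction using (sum; product)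
open import Data.Nat.ListAction.Properties using (sum-++; product-++)
open import Data.List.Membership.Propositional using (_∈_)
open import Data.List.Membership.Propositional.Properties using (∈-map⁺; ∈-concatMap⁺; ∈-upTo⁺)
open import Data.List.Relation.Unary.Any using (here; there)
import Data.List.Relation.Unary.Any as Any
open import Data.List.Relation.Unary.All using (All; []; _∷_)
open import Data.List.Relation.Unary.All.Properties using (++⁺; replicate⁺)
open import Data.List.Relation.Unary.Linked using (Linked; linked?; []; [-]; _∷_)
open import Function using (_∘_; Equivalence)
open import Relation.Binary.PropositionalEquality using (_≡_; _≢_; refl; sym; trans; cong; cong₂; subst; module ≡-Reasoning)
open import Relation.Nullary using (Dec; does; yes; no; ¬_)
open import Relation.Nullary.Decidable using (dec-true; dec-false)
open import Relation.Unary using (Decidable)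
open import Algebra.Properties.CommutativeSemigroup +-commutativeSemigroup using (interchange)

private
  variable
    A B : Set

𝟙 : Bool → ℕ
𝟙 b = if b then 1 else 0

1≤𝟙 : ∀ {b} → T b → 1 ≤ 𝟙 b
1≤𝟙 {true} _ = ≤-refl

𝟙≤1 : ∀ b → 𝟙 b ≤ 1
𝟙≤1 true  = ≤-refl
𝟙≤1 false = z≤n

if-mono : ∀ b {x y} → x ≤ y → (if b then x else 0) ≤ (if b then y else 0)
if-mono true  x≤y = x≤y
if-mono false _   = z≤n

∧-absorbˡ : ∀ x y → (T y → T x) → x ∧ y ≡ y
∧-absorbˡ x     false _ = ∧-zeroʳ x
∧-absorbˡ true  true  _ = refl
∧-absorbˡ false true  h = ⊥-elim (h _)

∧-shuffle : ∀ x s h l → (x ∧ s) ∧ (h ∧ l) ≡ x ∧ (h ∧ (s ∧ l))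
∧-shuffle false s     h l = refl
∧-shuffle true  true  h l = refl
∧-shuffle true  false h l = sym (∧-zeroʳ h)

T-does : ∀ {P : Set} (P? : Dec P) → P → T (does P?)
T-does P? p = subst T (sym (dec-true P? p)) _

m<ᵇ1+n≡m≤ᵇn : ∀ m n → does (m <? suc n) ≡ does (m ≤? n)
m<ᵇ1+n≡m≤ᵇn zero    n = refl
m<ᵇ1+n≡m≤ᵇn (suc m) n = refl

m+n≡ᵇo : ∀ m n o → does (m + n ≟ o) ≡ does (m ≤? o) ∧ does (n ≟ o ∸ m)
m+n≡ᵇo zero    n o       = refl
m+n≡ᵇo (suc m) n zero    = refl
m+n≡ᵇo (suc m) n (suc o) = trans (m+n≡ᵇo m n o) (cong (_∧ does (n ≟ o ∸ m)) (sym (m<ᵇ1+n≡m≤ᵇn m o)))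

n<m^n : ∀ {m} → 1 < m → ∀ n → n < m ^ n
n<m^n 1<m zero    = s≤s z≤n
n<m^n 1<m (suc n) = ≤-<-trans (n<m^n 1<m n) (^-monoʳ-< _ 1<m (n<1+n n))

m*[n/m]≤n : ∀ m n .{{_ : NonZero m}} → m * (n / m) ≤ n
m*[n/m]≤n m n = subst (_≤ n) (*-comm (n / m) m) (m/n*n≤m n m)

x/m+y/m≤[x+y]/m : ∀ m .{{_ : NonZero m}} x y → x / m + y / m ≤ (x + y) / m
x/m+y/m≤[x+y]/m m x y = subst (_≤ (x + y) / m) (m*n/n≡m (x / m + y / m) m)
  (/-monoˡ-≤ m (≤-trans (≤-reflexive (*-distribʳ-+ m (x / m) (y / m))) (+-mono-≤ (m/n*n≤m x m) (m/n*n≤m y m))))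

count : (A → Bool) → List A → ℕ
count p []       = 0
count p (x ∷ xs) = 𝟙 (p x) + count p xs

count-filter : ∀ {P Q : A → Set} (P? : Decidable P) (Q? : Decidable Q) xs →
               length (filter Q? (filter P? xs)) ≡ count (λ x → does (P? x) ∧ does (Q? x)) xs
count-filter P? Q? [] = refl
count-filter P? Q? (x ∷ xs) with does (P? x)
... | false = count-filter P? Q? xs
... | true with does (Q? x)
...   | true  = cong suc (count-filter P? Q? xs)
...   | false = count-filter P? Q? xs

count-++ : ∀ (p : A → Bool) xs ys → count p (xs ++ ys) ≡ count p xs + count p ys
count-++ p []       ys = refl
count-++ p (x ∷ xs) ys = trans (cong (𝟙 (p x) +_) (count-++ p xs ys)) (sym (+-assoc (𝟙 (p x)) _ _))

count-map : ∀ (p : B → Bool) (f : A → B) xs → count p (map f xs) ≡ count (p ∘ f) xs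
count-map p f []       = refl
count-map p f (x ∷ xs) = cong (𝟙 (p (f x)) +_) (count-map p f xs)

count-concatMap : ∀ (p : B → Bool) (f : A → List B) xs →
                  count p (concatMap f xs) ≡ sum (map (count p ∘ f) xs)
count-concatMap p f []       = refl
count-concatMap p f (x ∷ xs) = trans (count-++ p (f x) (concatMap f xs)) (cong (count p (f x) +_) (count-concatMap p f xs))

count-cong : ∀ {p q : A → Bool} → (∀ x → p x ≡ q x) → ∀ xs → count p xs ≡ count q xs
count-cong p≡q []       = refl
count-cong p≡q (x ∷ xs) = cong₂ _+_ (cong 𝟙 (p≡q x)) (count-cong p≡q xs)

count-∧ : ∀ b (p : A → Bool) xs → count (λ x → b ∧ p x) xs ≡ (if b then count p xs else 0)
count-∧ true  p xs       = refl
count-∧ false p []       = refl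
count-∧ false p (x ∷ xs) = count-∧ false p xs

count-≥1 : ∀ (p : A → Bool) {x xs} → x ∈ xs → T (p x) → 1 ≤ count p xs
count-≥1 p              (here refl) px = ≤-trans (1≤𝟙 px) (m≤m+n _ _)
count-≥1 p {xs = y ∷ _} (there x∈)  px = ≤-trans (count-≥1 p x∈ px) (m≤n+m _ (𝟙 (p y)))

count-≥2 : ∀ (p : A → Bool) {x y xs} → x ≢ y → x ∈ xs → y ∈ xs → T (p x) → T (p y) → 2 ≤ count p xs
count-≥2 p x≢y (here refl) (here refl) _ _ = ⊥-elim (x≢y refl)
count-≥2 p x≢y (here refl) (there y∈) px py = +-mono-≤ (1≤𝟙 px) (count-≥1 p y∈ py)
count-≥2 p x≢y (there x∈) (here refl) px py = +-mono-≤ (1≤𝟙 py) (count-≥1 p x∈ px)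
count-≥2 p {xs = z ∷ _} x≢y (there x∈) (there y∈) px py =
  ≤-trans (count-≥2 p x≢y x∈ y∈ px py) (m≤n+m _ (𝟙 (p z)))

count-allLists : ∀ (p : List ℕ → Bool) l as →
  count p (allLists (suc l) as) ≡ 𝟙 (p []) + sum (map (λ a → count (p ∘ (a ∷_)) (allLists l as)) as)
count-allLists p l as = cong (𝟙 (p []) +_) (trans
  (count-concatMap p (λ a → map (a ∷_) (allLists l as)) as)
  (cong sum (map-cong (λ a → count-map p (a ∷_) (allLists l as)) as)))

∈-allLists : ∀ {l as js} → All (_∈ as) js → length js ≤ l → js ∈ allLists l as
∈-allLists {zero}  []             _         = here refl
∈-allLists {suc l} []             _         = here refl
∈-allLists {suc l} (a∈as ∷ js∈as) (s≤s len) =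
  there (∈-concatMap⁺ _ (Any.map (λ { refl → ∈-map⁺ (_ ∷_) (∈-allLists js∈as len) }) a∈as))

sum-map-mono : ∀ {f g : A → ℕ} → (∀ x → f x ≤ g x) → ∀ xs → sum (map f xs) ≤ sum (map g xs)
sum-map-mono f≤g []       = z≤n
sum-map-mono f≤g (x ∷ xs) = +-mono-≤ (f≤g x) (sum-map-mono f≤g xs)

∑< : ℕ → (ℕ → ℕ) → ℕ
∑< zero    h = 0
∑< (suc K) h = ∑< K h + h K

sum-map-upTo : ∀ K h → sum (map h (upTo K)) ≡ ∑< K h
sum-map-upTo zero    h = refl
sum-map-upTo (suc K) h = begin
  sum (map h (upTo (suc K)))        ≡⟨ cong (sum ∘ map h) (sym (upTo-∷ʳ K)) ⟩
  sum (map h (upTo K ++ K ∷ []))    ≡⟨ cong sum (map-++ h (upTo K) (K ∷ [])) ⟩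
  sum (map h (upTo K) ++ h K ∷ [])  ≡⟨ sum-++ (map h (upTo K)) (h K ∷ []) ⟩
  sum (map h (upTo K)) + (h K + 0)  ≡⟨ cong₂ _+_ (sum-map-upTo K h) (+-identityʳ (h K)) ⟩
  ∑< K h + h K                      ∎
  where open ≡-Reasoning

∑<-cong : ∀ K {h h′} → (∀ i → i < K → h i ≡ h′ i) → ∑< K h ≡ ∑< K h′
∑<-cong zero    e = refl
∑<-cong (suc K) e = cong₂ _+_ (∑<-cong K (λ i i<K → e i (m<n⇒m<1+n i<K))) (e K ≤-refl)

∑<-zero : ∀ K {h} → (∀ i → i < K → h i ≡ 0) → ∑< K h ≡ 0
∑<-zero zero    z = refl
∑<-zero (suc K) z = cong₂ _+_ (∑<-zero K (λ i i<K → z i (m<n⇒m<1+n i<K))) (z K ≤-refl)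

∑<-mono : ∀ K {h h′} → (∀ i → h i ≤ h′ i) → ∑< K h ≤ ∑< K h′
∑<-mono zero    le = z≤n
∑<-mono (suc K) le = +-mono-≤ (∑<-mono K le) (le K)

∑<-monoˡ : ∀ h {K K′} → K ≤′ K′ → ∑< K h ≤ ∑< K′ h
∑<-monoˡ h ≤′-refl       = ≤-refl
∑<-monoˡ h (≤′-step K≤K′) = ≤-trans (∑<-monoˡ h K≤K′) (m≤m+n _ _)

∑<-tail : ∀ {h J K} → (∀ i → J ≤ i → h i ≡ 0) → J ≤′ K → ∑< K h ≡ ∑< J h
∑<-tail z ≤′-refl       = refl
∑<-tail z (≤′-step J≤K) = trans (cong₂ _+_ (∑<-tail z J≤K) (z _ (≤′⇒≤ J≤K))) (+-identityʳ _)

∑<-distrib-+ : ∀ K h h′ → ∑< K (λ i → h i + h′ i) ≡ ∑< K h + ∑< K h′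
∑<-distrib-+ zero    h h′ = refl
∑<-distrib-+ (suc K) h h′ =
  trans (cong (_+ (h K + h′ K)) (∑<-distrib-+ K h h′)) (interchange (∑< K h) (∑< K h′) (h K) (h′ K))

∑<-const-1 : ∀ K → ∑< K (λ _ → 1) ≡ K
∑<-const-1 zero    = refl
∑<-const-1 (suc K) = trans (cong (_+ 1) (∑<-const-1 K)) (+-comm K 1)

∑<-shift : ∀ M d h → ∑< (M + d) (λ i → if does (M ≤? i) then h (i ∸ M) else 0) ≡ ∑< d h
∑<-shift M d h = shifted d
  where
  open ≡-Reasoning
  φ : ℕ → ℕ
  φ i = if does (M ≤? i) then h (i ∸ M) else 0
  φ[M+d]≡h[d] : ∀ d → φ (M + d) ≡ h d
  φ[M+d]≡h[d] d =
    trans (cong (if_then h (M + d ∸ M) else 0) (dec-true (M ≤? M + d) (m≤m+n M d))) (cong h (m+n∸m≡n M d))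
  shifted : ∀ d → ∑< (M + d) φ ≡ ∑< d h
  shifted zero = begin
    ∑< (M + 0) φ  ≡⟨ cong (λ K → ∑< K φ) (+-identityʳ M) ⟩
    ∑< M φ        ≡⟨ ∑<-zero M (λ i i<M → cong (if_then h (i ∸ M) else 0) (dec-false (M ≤? i) (<⇒≱ i<M))) ⟩
    0             ∎
  shifted (suc d) = begin
    ∑< (M + suc d) φ          ≡⟨ cong (λ K → ∑< K φ) (+-suc M d) ⟩
    ∑< (M + d) φ + φ (M + d)  ≡⟨ cong₂ _+_ (shifted d) (φ[M+d]≡h[d] d) ⟩
    ∑< d h + h d              ∎

∑<-truncate : ∀ c K h → ∑< K (λ a → if does (a ≤? c) then h a else 0) ≤ ∑< (suc c) h
∑<-truncate c K h = by-cases (K ≤? suc c)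
  where
  open ≤-Reasoning
  φ : ℕ → ℕ
  φ a = if does (a ≤? c) then h a else 0
  φ≡h : ∀ a → a ≤ c → φ a ≡ h a
  φ≡h a a≤c = cong (if_then h a else 0) (dec-true (a ≤? c) a≤c)
  φ≡0 : ∀ a → suc c ≤ a → φ a ≡ 0
  φ≡0 a c<a = cong (if_then h a else 0) (dec-false (a ≤? c) (<⇒≱ c<a))
  by-cases : Dec (K ≤ suc c) → ∑< K φ ≤ ∑< (suc c) h
  by-cases (yes K≤1+c) = begin
    ∑< K φ        ≡⟨ ∑<-cong K (λ a a<K → φ≡h a (<⇒≤pred (<-≤-trans a<K K≤1+c))) ⟩
    ∑< K h        ≤⟨ ∑<-monoˡ h (≤⇒≤′ K≤1+c) ⟩
    ∑< (suc c) h  ∎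
  by-cases (no K≰1+c) = begin
    ∑< K φ        ≡⟨ ∑<-tail φ≡0 (≤⇒≤′ (<⇒≤ (≰⇒> K≰1+c))) ⟩
    ∑< (suc c) φ  ≡⟨ ∑<-cong (suc c) (λ a a<1+c → φ≡h a (≤-pred a<1+c)) ⟩
    ∑< (suc c) h  ∎

sum-replicate : ∀ a x → sum (replicate a x) ≡ a * x
sum-replicate zero    x = refl
sum-replicate (suc a) x = cong (x +_) (sum-replicate a x)

sum-replicate-++ : ∀ a x ys → sum (replicate a x ++ ys) ≡ a * x + sum ys
sum-replicate-++ a x ys = trans (sum-++ (replicate a x) ys) (cong (_+ sum ys) (sum-replicate a x))

linked-replicate-++ : ∀ a {x ys} → All (_≤ x) ys → Linked _≥_ ys → Linked _≥_ (replicate a x ++ ys)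
linked-replicate-++ zero          ys≤x      ys↓ = ys↓
linked-replicate-++ (suc zero)    []        ys↓ = [-]
linked-replicate-++ (suc zero)    (y≤x ∷ _) ys↓ = y≤x ∷ ys↓
linked-replicate-++ (suc (suc a)) ys≤x      ys↓ = ≤-refl ∷ linked-replicate-++ (suc a) ys≤x ys↓

linked-replicate : ∀ a x → Linked _≥_ (replicate a x)
linked-replicate a x = subst (Linked _≥_) (++-identityʳ (replicate a x)) (linked-replicate-++ a [] [])

bExt-replicate : ∀ m a x → bExt m (replicate a x) ≡ b m x ^ a
bExt-replicate m zero    x = refl
bExt-replicate m (suc a) x = cong (b m x *_) (bExt-replicate m a x)

bExt-replicate-++ : ∀ m a x ys → bExt m (replicate a x ++ ys) ≡ b m x ^ a * bExt m ys
bExt-replicate-++ m a x ys = begin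
  bExt m (replicate a x ++ ys)                         ≡⟨ cong product (map-++ (b m) (replicate a x) ys) ⟩
  product (map (b m) (replicate a x) ++ map (b m) ys)  ≡⟨ product-++ (map (b m) (replicate a x)) (map (b m) ys) ⟩
  bExt m (replicate a x) * bExt m ys                   ≡⟨ cong (_* bExt m ys) (bExt-replicate m a x) ⟩
  b m x ^ a * bExt m ys                                ∎
  where open ≡-Reasoning

-- Upper bound

module Bound (m : ℕ) .{{_ : NonZero m}} (m≥2 : 2 ≤ m) where

  headAtMost : ℕ → List ℕ → Bool
  headAtMost c []      = true
  headAtMost c (a ∷ _) = does (a ≤? c)

  isPartitionᵇ : ℕ → List ℕ → Bool
  isPartitionᵇ n js = does (sum (map (m ^_) js) ≟ n) ∧ does (linked? _≥?_ js)

  isPartitionᵇ≤ : ℕ → ℕ → List ℕ → Bool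
  isPartitionᵇ≤ n c js = headAtMost c js ∧ isPartitionᵇ n js

  b≡count : ∀ n → b m n ≡ count (isPartitionᵇ n) (allLists n (upTo (suc n)))
  b≡count n = count-filter (λ js → sum (map (m ^_) js) ≟ n) (linked? _≥?_) (allLists n (upTo (suc n)))

  linked?-∷ : ∀ a js → does (linked? _≥?_ (a ∷ js)) ≡ headAtMost a js ∧ does (linked? _≥?_ js)
  linked?-∷ a []      = refl
  linked?-∷ a (_ ∷ _) = refl

  isPartitionᵇ-∷ : ∀ n a js → isPartitionᵇ n (a ∷ js) ≡ does (m ^ a ≤? n) ∧ isPartitionᵇ≤ (n ∸ m ^ a) a js
  isPartitionᵇ-∷ n a js rewrite m+n≡ᵇo (m ^ a) (sum (map (m ^_) js)) n | linked?-∷ a js =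
    ∧-shuffle (does (m ^ a ≤? n)) (does (sum (map (m ^_) js) ≟ n ∸ m ^ a)) (headAtMost a js) (does (linked? _≥?_ js))

  isPartitionᵇ≡isPartitionᵇ≤ : ∀ n js → isPartitionᵇ n js ≡ isPartitionᵇ≤ n n js
  isPartitionᵇ≡isPartitionᵇ≤ n []       = refl
  isPartitionᵇ≡isPartitionᵇ≤ n (a ∷ js) = sym (∧-absorbˡ _ _ head≤n)
    where
    head≤n : T (isPartitionᵇ n (a ∷ js)) → T (does (a ≤? n))
    head≤n t = ≤⇒≤ᵇ (<⇒≤ (<-≤-trans (n<m^n m≥2 a) (≤ᵇ⇒≤ (m ^ a) n m^a≤n)))
      where m^a≤n = proj₁ (Equivalence.to T-∧ (subst T (isPartitionᵇ-∷ n a js) t))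

  bBounded : ℕ → ℕ → ℕ
  bBounded n zero    = 1
  bBounded n (suc c) = ∑< (suc (n / m)) (λ i → bBounded i c)

  -- the number of m-ary partitions of n whose largest part is m ^ a
  bLargest : ℕ → ℕ → ℕ
  bLargest n a = if does (m ^ a ≤? n) then bBounded (n ∸ m ^ a) a else 0

  bLargest-≤ : ∀ {n} a → m ^ a ≤ n → bLargest n a ≡ bBounded (n ∸ m ^ a) a
  bLargest-≤ {n} a le = cong (if_then bBounded (n ∸ m ^ a) a else 0) (dec-true (m ^ a ≤? n) le)

  bLargest-≰ : ∀ {n} a → ¬ m ^ a ≤ n → bLargest n a ≡ 0
  bLargest-≰ {n} a nle = cong (if_then bBounded (n ∸ m ^ a) a else 0) (dec-false (m ^ a ≤? n) nle)

  bBounded-pos : ∀ n c → 1 ≤ bBounded n c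
  bBounded-pos n zero    = ≤-refl
  bBounded-pos n (suc c) = ≤-trans (bBounded-pos (n / m) c) (m≤n+m _ _)

  -- (an equality: a partition into parts at most m ^ (c + 1) either has largest part m ^ (c + 1) or not)
  bBounded-step : ∀ c n → bBounded n c + bLargest n (suc c) ≤ bBounded n (suc c)
  bBounded-step zero n with m ^ 1 ≤? n
  ... | no m≰n = begin
    1 + bLargest n 1            ≡⟨ cong suc (bLargest-≰ 1 m≰n) ⟩
    1                           ≤⟨ s≤s z≤n ⟩
    suc (n / m)                 ≡⟨ ∑<-const-1 (suc (n / m)) ⟨
    ∑< (suc (n / m)) (λ _ → 1)  ∎
    where open ≤-Reasoning
  ... | yes m≤n = ≤-reflexive (begin
    1 + bLargest n 1                          ≡⟨ cong suc (bLargest-≤ 1 m≤n) ⟩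
    1 + ∑< (suc ((n ∸ m ^ 1) / m)) (λ _ → 1)  ≡⟨ cong suc (∑<-const-1 _) ⟩
    suc (suc ((n ∸ m ^ 1) / m))               ≡⟨ cong (λ x → suc (suc ((n ∸ x) / m))) (*-identityʳ m) ⟩
    suc (suc ((n ∸ m) / m))                   ≡⟨ cong (suc ∘ suc) ([m∸n]/n≡m/n∸1 n m) ⟩
    suc (suc (pred (n / m)))                  ≡⟨ cong suc (suc-pred (n / m) {{>-nonZero q>0}}) ⟩
    suc (n / m)                               ≡⟨ ∑<-const-1 (suc (n / m)) ⟨
    ∑< (suc (n / m)) (λ _ → 1)                ∎)
    where
    open ≡-Reasoning
    q>0 = m≥n⇒m/n>0 (subst (_≤ n) (*-identityʳ m) m≤n)
  bBounded-step (suc c) n = begin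
    bBounded n (suc c) + bLargest n (suc (suc c))                            ≤⟨ +-monoʳ-≤ (bBounded n (suc c)) top≤ ⟩
    ∑< (suc k) (λ i → bBounded i c) + ∑< (suc k) (λ i → bLargest i (suc c))  ≡⟨ ∑<-distrib-+ (suc k) _ _ ⟨
    ∑< (suc k) (λ i → bBounded i c + bLargest i (suc c))                     ≤⟨ ∑<-mono (suc k) (bBounded-step c) ⟩
    bBounded n (suc (suc c))                                                 ∎
    where
    open ≤-Reasoning
    k = n / m
    M = m ^ suc c
    -- a partition of n with largest part m · M has its parts other than 1 equal to m times
    -- a partition of some i ≤ k with largest part M
    top≤ : bLargest n (suc (suc c)) ≤ ∑< (suc k) (λ i → bLargest i (suc c))
    top≤ with m * M ≤? n
    ... | no mM≰n = ≤-trans (≤-reflexive (bLargest-≰ (suc (suc c)) mM≰n)) z≤n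
    ... | yes mM≤n = begin
      bLargest n (suc (suc c))                               ≡⟨ bLargest-≤ (suc (suc c)) mM≤n ⟩
      ∑< (suc ((n ∸ m * M) / m)) (λ j → bBounded j (suc c))  ≡⟨ cong (λ x → ∑< (suc x) _) [n∸mM]/m≡k∸M ⟩
      ∑< (suc (k ∸ M)) (λ j → bBounded j (suc c))            ≡⟨ ∑<-shift M (suc (k ∸ M)) _ ⟨
      ∑< (M + suc (k ∸ M)) (λ i → bLargest i (suc c))        ≡⟨ cong (λ K → ∑< K (λ i → bLargest i (suc c))) M+[1+k∸M]≡1+k ⟩
      ∑< (suc k) (λ i → bLargest i (suc c))                  ∎
      where
      M≤k : M ≤ k
      M≤k = subst (_≤ k) (m*n/n≡m M m) (/-monoˡ-≤ m (subst (_≤ n) (*-comm m M) mM≤n))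
      [n∸mM]/m≡k∸M : (n ∸ m * M) / m ≡ k ∸ M
      [n∸mM]/m≡k∸M = trans (cong (λ x → (n ∸ x) / m) (*-comm m M)) ([m∸n*o]/o≡m/o∸n n M m)
      M+[1+k∸M]≡1+k : M + suc (k ∸ M) ≡ suc k
      M+[1+k∸M]≡1+k = trans (+-suc M (k ∸ M)) (cong suc (m+[n∸m]≡n M≤k))

  bBounded-split : ∀ c n → 𝟙 (does (0 ≟ n)) + ∑< (suc c) (bLargest n) ≤ bBounded n c
  bBounded-split zero    zero    = ≤-refl
  bBounded-split zero    (suc n) = ≤-refl
  bBounded-split (suc c) n = begin
    𝟙 (does (0 ≟ n)) + (∑< (suc c) (bLargest n) + bLargest n (suc c))  ≡⟨ +-assoc (𝟙 (does (0 ≟ n))) _ _ ⟨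
    𝟙 (does (0 ≟ n)) + ∑< (suc c) (bLargest n) + bLargest n (suc c)    ≤⟨ +-monoˡ-≤ _ (bBounded-split c n) ⟩
    bBounded n c + bLargest n (suc c)                                  ≤⟨ bBounded-step c n ⟩
    bBounded n (suc c)                                                 ∎
    where open ≤-Reasoning

  -- allLists branches on the first, i.e. largest, exponent a; the tails then have head at most a.
  count-isPartitionᵇ≤ : ∀ l n c K → count (isPartitionᵇ≤ n c) (allLists l (upTo K)) ≤ bBounded n c
  count-isPartitionᵇ≤ zero    n c K = ≤-trans (≤-reflexive (+-identityʳ _)) (≤-trans (𝟙≤1 _) (bBounded-pos n c))
  count-isPartitionᵇ≤ (suc l) n c K = begin
    count (isPartitionᵇ≤ n c) (allLists (suc l) (upTo K))  ≡⟨ count-allLists (isPartitionᵇ≤ n c) l (upTo K) ⟩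
    𝟙 (isPartitionᵇ≤ n c []) + sum (map byHead (upTo K))   ≤⟨ +-monoʳ-≤ _ (sum-map-mono byHead≤bound (upTo K)) ⟩
    𝟙 (isPartitionᵇ≤ n c []) + sum (map bound (upTo K))    ≡⟨ cong₂ _+_ (cong 𝟙 (∧-identityʳ _)) (sum-map-upTo K bound) ⟩
    𝟙 (does (0 ≟ n)) + ∑< K bound                          ≤⟨ +-monoʳ-≤ _ (∑<-truncate c K (bLargest n)) ⟩
    𝟙 (does (0 ≟ n)) + ∑< (suc c) (bLargest n)             ≤⟨ bBounded-split c n ⟩
    bBounded n c                                           ∎
    where
    open ≤-Reasoning
    X = allLists l (upTo K)
    byHead bound : ℕ → ℕ
    byHead a = count (isPartitionᵇ≤ n c ∘ (a ∷_)) X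
    bound  a = if does (a ≤? c) then bLargest n a else 0
    byHead≤bound : ∀ a → byHead a ≤ bound a
    byHead≤bound a = begin
      byHead a
        ≡⟨ count-cong (λ js → cong (does (a ≤? c) ∧_) (isPartitionᵇ-∷ n a js)) X ⟩
      count (λ js → does (a ≤? c) ∧ (does (m ^ a ≤? n) ∧ isPartitionᵇ≤ (n ∸ m ^ a) a js)) X
        ≡⟨ count-∧ (does (a ≤? c)) _ X ⟩
      (if does (a ≤? c) then count (λ js → does (m ^ a ≤? n) ∧ isPartitionᵇ≤ (n ∸ m ^ a) a js) X else 0)
        ≡⟨ cong (if does (a ≤? c) then_else 0) (count-∧ (does (m ^ a ≤? n)) _ X) ⟩
      (if does (a ≤? c) then (if does (m ^ a ≤? n) then count (isPartitionᵇ≤ (n ∸ m ^ a) a) X else 0) else 0)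
        ≤⟨ if-mono (does (a ≤? c)) (if-mono (does (m ^ a ≤? n)) (count-isPartitionᵇ≤ l (n ∸ m ^ a) a K)) ⟩
      bound a ∎

  b≤bBounded : ∀ n → b m n ≤ bBounded n n
  b≤bBounded n = begin
    b m n                                                  ≡⟨ b≡count n ⟩
    count (isPartitionᵇ n) (allLists n (upTo (suc n)))     ≡⟨ count-cong (isPartitionᵇ≡isPartitionᵇ≤ n) (allLists n (upTo (suc n))) ⟩
    count (isPartitionᵇ≤ n n) (allLists n (upTo (suc n)))  ≤⟨ count-isPartitionᵇ≤ n n n (suc n) ⟩
    bBounded n n                                           ∎
    where open ≤-Reasoning

  ∑<2^[i/m]≤2^k : ∀ k → ∑< (suc k) (λ i → 2 ^ (i / m)) ≤ 2 ^ k
  ∑<2^[i/m]≤2^k zero    = ≤-reflexive (cong (2 ^_) (0/n≡0 m))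
  ∑<2^[i/m]≤2^k (suc k) = begin
    ∑< (suc k) (λ i → 2 ^ (i / m)) + 2 ^ (suc k / m)  ≤⟨ +-mono-≤ (∑<2^[i/m]≤2^k k) (^-monoʳ-≤ 2 [1+k]/m≤k) ⟩
    2 ^ k + 2 ^ k                                     ≡⟨ cong (2 ^ k +_) (+-identityʳ (2 ^ k)) ⟨
    2 ^ suc k                                         ∎
    where
    open ≤-Reasoning
    [1+k]/m≤k = ≤-pred (m/n<m (suc k) m m≥2)

  bBounded≤2^[n/m] : ∀ n c → bBounded n c ≤ 2 ^ (n / m)
  bBounded≤2^[n/m] n zero    = m^n>0 2 (n / m)
  bBounded≤2^[n/m] n (suc c) = ≤-trans (∑<-mono (suc (n / m)) (λ i → bBounded≤2^[n/m] i c)) (∑<2^[i/m]≤2^k (n / m))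

  b≤2^[n/m] : ∀ n → b m n ≤ 2 ^ (n / m)
  b≤2^[n/m] n = ≤-trans (b≤bBounded n) (bBounded≤2^[n/m] n n)

  bExt≤2^[sum/m] : ∀ μ → bExt m μ ≤ 2 ^ (sum μ / m)
  bExt≤2^[sum/m] []      = ≤-reflexive (cong (2 ^_) (sym (0/n≡0 m)))
  bExt≤2^[sum/m] (x ∷ μ) = begin
    b m x * bExt m μ               ≤⟨ *-mono-≤ (b≤2^[n/m] x) (bExt≤2^[sum/m] μ) ⟩
    2 ^ (x / m) * 2 ^ (sum μ / m)  ≡⟨ ^-distribˡ-+-* 2 (x / m) _ ⟨
    2 ^ (x / m + sum μ / m)        ≤⟨ ^-monoʳ-≤ 2 (x/m+y/m≤[x+y]/m m x (sum μ)) ⟩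
    2 ^ ((x + sum μ) / m)          ∎
    where open ≤-Reasoning

  bExt≤2^[n/m] : ∀ {n μ} → MaryPartition m n μ → bExt m μ ≤ 2 ^ (n / m)
  bExt≤2^[n/m] {μ = μ} (_ , _ , refl) = bExt≤2^[sum/m] μ

  attainsMax : ∀ {n λs} → MaryPartition m n λs → 2 ^ (n / m) ≤ bExt m λs → AttainsMax m n λs
  attainsMax λp lower = λp , λ μ μp → ≤-trans (bExt≤2^[n/m] μp) lower

  -- Extremal partitions

  replicate0-isPartitionᵇ : ∀ n → T (isPartitionᵇ n (replicate n 0))
  replicate0-isPartitionᵇ n = Equivalence.from T-∧ (≡⇒≡ᵇ _ n sum≡n , T-does (linked? _≥?_ _) (linked-replicate n 0))
    where
    sum≡n : sum (map (m ^_) (replicate n 0)) ≡ n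
    sum≡n = trans (cong sum (map-replicate (m ^_) n 0)) (trans (sum-replicate n 1) (*-identityʳ n))

  replicate0∈allLists : ∀ n → replicate n 0 ∈ allLists n (upTo (suc n))
  replicate0∈allLists n = ∈-allLists (replicate⁺ n (∈-upTo⁺ (s≤s z≤n))) (≤-reflexive (length-replicate n))

  1≤b : ∀ n → 1 ≤ b m n
  1≤b n = subst (1 ≤_) (sym (b≡count n))
    (count-≥1 (isPartitionᵇ n) (replicate0∈allLists n) (replicate0-isPartitionᵇ n))

  2≤b[m] : 2 ≤ b m m
  2≤b[m] = subst (2 ≤_) (sym (b≡count m))
    (count-≥2 (isPartitionᵇ m) [1]≢0^m
      (∈-allLists (∈-upTo⁺ (s≤s (<⇒≤ m≥2)) ∷ []) (<⇒≤ m≥2)) (replicate0∈allLists m)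
      (Equivalence.from T-∧ (≡⇒≡ᵇ _ m (trans (+-identityʳ _) (*-identityʳ m)) , _))
      (replicate0-isPartitionᵇ m))
    where
    [1]≢0^m : 1 ∷ [] ≢ replicate m 0
    [1]≢0^m eq = <⇒≢ m≥2 (trans (cong length eq) (length-replicate m))

  blocks : ℕ → List ℕ
  blocks n = replicate (n / m) m ++ replicate (n ∸ m * (n / m)) 1

  blocks-partition : ∀ n → MaryPartition m n (blocks n)
  blocks-partition n =
      linked-replicate-++ (n / m) (replicate⁺ r (<⇒≤ m≥2)) (linked-replicate r 1)
    , ++⁺ (replicate⁺ (n / m) (1 , *-identityʳ m)) (replicate⁺ r (0 , refl))
    , (begin
      sum (blocks n)                   ≡⟨ sum-replicate-++ (n / m) m _ ⟩
      n / m * m + sum (replicate r 1)  ≡⟨ cong₂ _+_ (*-comm (n / m) m) (trans (sum-replicate r 1) (*-identityʳ r)) ⟩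
      m * (n / m) + r                  ≡⟨ m+[n∸m]≡n (m*[n/m]≤n m n) ⟩
      n                                ∎)
    where
    open ≡-Reasoning
    r = n ∸ m * (n / m)

  2^[n/m]≤bExt-blocks : ∀ n → 2 ^ (n / m) ≤ bExt m (blocks n)
  2^[n/m]≤bExt-blocks n = begin
    2 ^ q                               ≡⟨ *-identityʳ _ ⟨
    2 ^ q * 1                           ≡⟨ cong (2 ^ q *_) (^-zeroˡ r) ⟨
    2 ^ q * 1 ^ r                       ≤⟨ *-mono-≤ (^-monoˡ-≤ q 2≤b[m]) (^-monoˡ-≤ r (1≤b 1)) ⟩
    b m m ^ q * b m 1 ^ r               ≡⟨ cong (b m m ^ q *_) (bExt-replicate m r 1) ⟨
    b m m ^ q * bExt m (replicate r 1)  ≡⟨ bExt-replicate-++ m q m (replicate r 1) ⟨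
    bExt m (blocks n)                   ∎
    where
    open ≤-Reasoning
    q = n / m
    r = n ∸ m * q

  blocks-attainsMax : ∀ n → AttainsMax m n (blocks n)
  blocks-attainsMax n = attainsMax (blocks-partition n) (2^[n/m]≤bExt-blocks n)

  bExt-blocks≡2^[n/m] : ∀ n → bExt m (blocks n) ≡ 2 ^ (n / m)
  bExt-blocks≡2^[n/m] n = ≤-antisym (bExt≤2^[n/m] (blocks-partition n)) (2^[n/m]≤bExt-blocks n)

binary-blocks-attainsMax : ∀ n i → i ≤ n / 4 →
  AttainsMax 2 n (replicate i 4 ++ replicate (n / 2 ∸ 2 * i) 2 ++ replicate (n ∸ 2 * (n / 2)) 1)
binary-blocks-attainsMax n i i≤n/4 = attainsMax partition (≤-reflexive 2^q≡bExt)
  where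
  open Bound 2 ≤-refl using (attainsMax)
  open ≡-Reasoning
  q = n / 2
  a = q ∸ 2 * i
  r = n ∸ 2 * q
  2i≤q : 2 * i ≤ q
  2i≤q = ≤-trans (*-monoʳ-≤ 2 i≤n/4) (subst (λ x → 2 * x ≤ q) (m/n/o≡m/[n*o] n 2 2) (m*[n/m]≤n 2 q))
  regroup : ∀ i a r → i * 4 + (a * 2 + r) ≡ 2 * (2 * i + a) + r
  regroup = solve-∀
  partition : MaryPartition 2 n (replicate i 4 ++ replicate a 2 ++ replicate r 1)
  partition =
      linked-replicate-++ i (++⁺ (replicate⁺ a (s≤s (s≤s z≤n))) (replicate⁺ r (s≤s z≤n)))
        (linked-replicate-++ a (replicate⁺ r (s≤s z≤n)) (linked-replicate r 1))
    , ++⁺ (replicate⁺ i (2 , refl)) (++⁺ (replicate⁺ a (1 , refl)) (replicate⁺ r (0 , refl)))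
    , (begin
      sum (replicate i 4 ++ replicate a 2 ++ replicate r 1)  ≡⟨ sum-replicate-++ i 4 _ ⟩
      i * 4 + sum (replicate a 2 ++ replicate r 1)           ≡⟨ cong (i * 4 +_) (sum-replicate-++ a 2 _) ⟩
      i * 4 + (a * 2 + sum (replicate r 1))                  ≡⟨ cong (λ x → i * 4 + (a * 2 + x)) (trans (sum-replicate r 1) (*-identityʳ r)) ⟩
      i * 4 + (a * 2 + r)                                    ≡⟨ regroup i a r ⟩
      2 * (2 * i + a) + r                                    ≡⟨ cong (λ x → 2 * x + r) (m+[n∸m]≡n 2i≤q) ⟩
      2 * q + r                                              ≡⟨ m+[n∸m]≡n (m*[n/m]≤n 2 n) ⟩
      n                                                      ∎)
  -- b 2 4 = 4, b 2 2 = 2 and b 2 1 = 1 hold by evaluation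
  2^q≡bExt : 2 ^ q ≡ bExt 2 (replicate i 4 ++ replicate a 2 ++ replicate r 1)
  2^q≡bExt = begin
    2 ^ q                                   ≡⟨ cong (2 ^_) (m+[n∸m]≡n 2i≤q) ⟨
    2 ^ (2 * i + a)                         ≡⟨ ^-distribˡ-+-* 2 (2 * i) a ⟩
    2 ^ (2 * i) * 2 ^ a                     ≡⟨ cong₂ _*_ (^-*-assoc 2 2 i) (*-identityʳ (2 ^ a)) ⟨
    4 ^ i * (2 ^ a * 1)                     ≡⟨ cong (λ x → 4 ^ i * (2 ^ a * x)) (^-zeroˡ r) ⟨
    b 2 4 ^ i * (b 2 2 ^ a * b 2 1 ^ r)     ≡⟨ cong (λ x → b 2 4 ^ i * (b 2 2 ^ a * x)) (bExt-replicate 2 r 1) ⟨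
    b 2 4 ^ i * (b 2 2 ^ a * bExt 2 (replicate r 1))
      ≡⟨ cong (b 2 4 ^ i *_) (bExt-replicate-++ 2 a 2 (replicate r 1)) ⟨
    b 2 4 ^ i * bExt 2 (replicate a 2 ++ replicate r 1)
      ≡⟨ bExt-replicate-++ 2 i 4 (replicate a 2 ++ replicate r 1) ⟨
    bExt 2 (replicate i 4 ++ replicate a 2 ++ replicate r 1) ∎

theorem4p5 : (m n : ℕ) → .{{_ : NonZero m}} → 2 ≤ m → 1 ≤ n →
    (3 ≤ m →
      AttainsMax m n (replicate (n / m) m ++ replicate (n ∸ m * (n / m)) 1))
    × (m ≡ 2 → (i : ℕ) → i ≤ n / 4 →
      AttainsMax 2 n (replicate i 4 ++ replicate (n / 2 ∸ 2 * i) 2 ++ replicate (n ∸ 2 * (n / 2)) 1))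
    × ((∃[ λs ] (MaryPartition m n λs × bExt m λs ≡ 2 ^ (n / m)))
      × (∀ μ → MaryPartition m n μ → bExt m μ ≤ 2 ^ (n / m)))
theorem4p5 m n m≥2 _ =
    (λ _ → blocks-attainsMax n)
  , (λ _ → binary-blocks-attainsMax n)
  , (blocks n , blocks-partition n , bExt-blocks≡2^[n/m] n)
  , (λ _ → bExt≤2^[n/m])
  where open Bound m m≥2
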